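{- Let $G$ be a graph and $m \in \mathbb{N}$ such that $P_{DP}(G,m) = P(G,m)$. Then $P_{DP}(K_1 \vee G, m+1) = P(K_1 \vee G, m+1)$.
   Context: All graphs are finite and simple; $K_1 \vee G$ is the join of a single vertex with $G$. A cover of a graph $G$ is a pair $\mathcal{H}=(L,H)$ where $H$ is a graph and $L: V(G) \to \mathcal{P}(V(H))$ satisfies: (1) $\{L(u): u \in V(G)\}$ is a partition of $V(H)$ into $|V(G)|$ parts; (2) $H[L(u)]$ is complete for each $u$; (3) if there is an edge of $H$ between $L(u)$ and $L(v)$ with $u \neq v$, then $uv \in E(G)$; (4) if $uv \in E(G)$, the edges of $H$ between $L(u)$ and $L(v)$ form a (possibly empty) matching. The cover is $m$-fold if $|L(u)|=m$ for all $u$. An $\mathcal{H}$-coloring of $G$ is an independent set of $H$ of size $|V(G)|$. $P_{DP}(G,m)$ is the minimum number of $\mathcal{H}$-colorings of $G$ over all $m$-fold covers $\mathcal{H}$ of $G$; $P(G,m)$ is the chromatic polynomial. -}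

module Defs where

open import Data.Nat using (ℕ; zero; suc; _≤_)
open import Data.Fin using (Fin; zero; suc)
open import Data.Fin.Properties using (_≟_)
open import Data.Bool using (Bool; true; false; not; _∧_; _∨_; if_then_else_)
open import Data.List using (List; []; _∷_; map; concatMap)
open import Data.Vec.Functional using () renaming (_∷_ to _∷ᶠ_)
open import Data.Product using (Σ; _×_; _,_)
open import Relation.Nullary using (¬_)
open import Relation.Nullary.Decidable using (⌊_⌋)
open import Relation.Binary.PropositionalEquality using (_≡_; _≢_)

allFin : (n : ℕ) → List (Fin n)
allFin n = Data.List.allFin n

countB : {A : Set} → (A → Bool) → List A → ℕ
countB p [] = zero
countB p (x ∷ xs) = if p x then suc (countB p xs) else countB p xs

allB : {A : Set} → (A → Bool) → List A → Bool
allB p [] = true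
allB p (x ∷ xs) = p x ∧ allB p xs

eqF : {n : ℕ} → Fin n → Fin n → Bool
eqF i j = ⌊ i ≟ j ⌋

record Graph : Set where
  field
    n      : ℕ
    adj    : Fin n → Fin n → Bool
    sym    : ∀ i j → adj i j ≡ adj j i
    irrefl : ∀ i → adj i i ≡ false
open Graph public

allFuns : {A : Set} → List A → (n : ℕ) → List (Fin n → A)
allFuns xs zero = (λ ()) ∷ []
allFuns xs (suc n) = concatMap (λ c → map (λ g → c ∷ᶠ g) (allFuns xs n)) xs

proper : (G : Graph) {m : ℕ} → (Fin (n G) → Fin m) → Bool
proper G c = allB (λ i → allB (λ j → not (adj G i j) ∨ not (eqF (c i) (c j))) (allFin (n G))) (allFin (n G))

P : Graph → ℕ → ℕ
P G m = countB (proper G) (allFuns (allFin m) (n G))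

-- K₁ ∨ G : new vertex zero adjacent to every vertex of G
join1 : Graph → Graph
join1 G = record { n = suc (n G) ; adj = a ; sym = s ; irrefl = ir }
  where
  a : Fin (suc (n G)) → Fin (suc (n G)) → Bool
  a zero zero = false
  a zero (suc j) = true
  a (suc i) zero = true
  a (suc i) (suc j) = adj G i j
  s : ∀ i j → a i j ≡ a j i
  s zero zero = Relation.Binary.PropositionalEquality.refl
  s zero (suc j) = Relation.Binary.PropositionalEquality.refl
  s (suc i) zero = Relation.Binary.PropositionalEquality.refl
  s (suc i) (suc j) = sym G i j
  ir : ∀ i → a i i ≡ false
  ir zero = Relation.Binary.PropositionalEquality.refl
  ir (suc i) = irrefl G i

-- A cover (L, H) of G. The partition {L(u)} of V(H) = Fin (n H) indexed by V(G)
-- is encoded by the map own : V(H) → V(G), with L(u) = own⁻¹(u).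
record Cover (G : Graph) : Set where
  field
    H        : Graph
    own      : Fin (n H) → Fin (n G)
    clique   : ∀ x y → x ≢ y → own x ≡ own y → adj H x y ≡ true
    overEdge : ∀ x y → adj H x y ≡ true → own x ≢ own y → adj G (own x) (own y) ≡ true
    matching : ∀ x y y' → own x ≢ own y → own y ≡ own y'
               → adj H x y ≡ true → adj H x y' ≡ true → y ≡ y'
open Cover public

partSize : {G : Graph} → Cover G → Fin (n G) → ℕ
partSize 𝓗 u = countB (λ x → eqF (own 𝓗 x) u) (allFin (n (H 𝓗)))

IsMFold : {G : Graph} → Cover G → ℕ → Set
IsMFold {G} 𝓗 m = ∀ u → partSize 𝓗 u ≡ m

independent : (K : Graph) → (Fin (n K) → Bool) → Bool
independent K S = allB (λ x → allB (λ y → not (S x ∧ S y ∧ adj K x y)) (allFin (n K))) (allFin (n K))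

size : {N : ℕ} → (Fin N → Bool) → ℕ
size {N} S = countB S (allFin N)

-- number of 𝓗-colourings: independent sets of H of size |V(G)|
numColourings : {G : Graph} → Cover G → ℕ
numColourings {G} 𝓗 =
  countB (λ S → independent (H 𝓗) S ∧ eqℕ (size S) (n G))
         (allFuns (true ∷ false ∷ []) (n (H 𝓗)))
  where
  open import Data.Nat.Properties using () renaming (_≟_ to _≟ℕ_)
  eqℕ : ℕ → ℕ → Bool
  eqℕ a b = ⌊ a ≟ℕ b ⌋

-- "P_DP(G,m) = k": k is the minimum number of 𝓗-colourings over all m-fold covers 𝓗
PDP≡ : Graph → ℕ → ℕ → Set
PDP≡ G m k =
  (Σ (Cover G) λ 𝓗 → IsMFold 𝓗 m × numColourings 𝓗 ≡ k)
  × (∀ (𝓗 : Cover G) → IsMFold 𝓗 m → k ≤ numColourings 𝓗)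

-- Upper bound: the canonical (m+1)-fold cover of K₁ ∨ G, with one vertex (v, c) per vertex v and
-- colour c, whose parts are cliques and whose edges join (u, c) to (v, c) along each edge uv, has
-- exactly the proper colourings as its colourings.  Fixing the colour of the apex first gives
-- P(K₁ ∨ G, m+1) = (m+1) P(G, m).
--
-- Lower bound: let 𝓗 be an (m+1)-fold cover of K₁ ∨ G and x a vertex of the apex part L(0).  Deleting
-- L(0) and, from every other part, the neighbour of x (or an arbitrary vertex if x has none there)
-- leaves an m-fold cover of G, and adding x to any of its colourings gives an 𝓗-colouring.  Hence at
-- least P_DP(G, m) = P(G, m) 𝓗-colourings contain x.  As L(0) is a clique, no 𝓗-colouring contains
-- two of its m+1 vertices, so 𝓗 has at least (m+1) P(G, m) colourings.

module Submission where

open import Defs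
import Data.Nat.Properties as ℕ
open import Algebra.Properties.CommutativeSemigroup ℕ.+-commutativeSemigroup using (interchange)
import Data.Bool.Properties as Bool
open import Data.Bool using (Bool; true; false; not; _∧_; _∨_; if_then_else_)
open import Data.Bool.Properties using (∧-comm; ∧-zeroʳ; ∧-identityʳ)
open import Data.Empty using (⊥-elim)
open import Data.Fin using (Fin; zero; suc; punchIn; punchOut; quotient; remainder; combine)
open import Data.Fin.Properties
  using (_≟_; suc-injective; 0≢1+n; punchIn-injective; punchInᵢ≢i; punchIn-punchOut; any?; remQuot-combine; combine-remQuot)
open import Data.List using (List; []; _∷_; _++_; map; concatMap; tabulate)
open import Data.List.Relation.Unary.All using (All; []; _∷_)
open import Data.List.Relation.Unary.AllPairs using ([]; _∷_)
open import Data.List.Relation.Unary.Unique.Propositional using (Unique)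
open import Data.List.Relation.Unary.Unique.Propositional.Properties using (allFin⁺)
open import Data.Nat using (ℕ; zero; suc; _+_; _*_; _≤_; z≤n; s≤s)
open import Data.Nat.Properties
  using (≤-trans; ≤-reflexive; 1+n≰n; m≤n⇒m≤1+n; +-mono-≤; +-comm; +-suc; +-identityʳ; *-identityʳ)
  renaming (suc-injective to suc-injective′)
open import Data.Product using (Σ; _×_; _,_; proj₁; proj₂)
open import Data.Vec.Functional using () renaming (_∷_ to _∷ᶠ_)
open import Function using (_∘_)
open import Relation.Nullary using (¬_; Dec; yes; no)
open import Relation.Nullary.Decidable using (⌊_⌋; dec-true; dec-false; isYes≗does; _×-dec_)
open import Relation.Binary.Definitions using (DecidableEquality)
open import Relation.Binary.PropositionalEquality hiding (sym)
import Relation.Binary.PropositionalEquality as ≡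

≡true⇒≢false : ∀ {b} → b ≡ true → b ≢ false
≡true⇒≢false refl ()

bool-ext : {a b : Bool} → (a ≡ true → b ≡ true) → (b ≡ true → a ≡ true) → a ≡ b
bool-ext {true}  {true}  _ _ = refl
bool-ext {true}  {false} f _ = ≡.sym (f refl)
bool-ext {false} {true}  _ g = g refl
bool-ext {false} {false} _ _ = refl

∧-true⁺ : ∀ {a b} → a ≡ true → b ≡ true → a ∧ b ≡ true
∧-true⁺ refl refl = refl

∧-true⁻ˡ : ∀ {a b} → a ∧ b ≡ true → a ≡ true
∧-true⁻ˡ {true} _ = refl

∧-true⁻ʳ : ∀ {a b} → a ∧ b ≡ true → b ≡ true
∧-true⁻ʳ {true} h = h

not-true⁻ : ∀ {a} → not a ≡ true → a ≡ false
not-true⁻ {false} _ = refl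

isYes-true⁻ : {P : Set} (d : Dec P) → ⌊ d ⌋ ≡ true → P
isYes-true⁻ (yes p) _ = p

isYes-true⁺ : {P : Set} (d : Dec P) → P → ⌊ d ⌋ ≡ true
isYes-true⁺ d p = trans (isYes≗does d) (dec-true d p)

isYes-false⁺ : {P : Set} (d : Dec P) → ¬ P → ⌊ d ⌋ ≡ false
isYes-false⁺ d ¬p = trans (isYes≗does d) (dec-false d ¬p)

eqF-true⁻ : ∀ {n} {a b : Fin n} → eqF a b ≡ true → a ≡ b
eqF-true⁻ {a = a} {b} = isYes-true⁻ (a ≟ b)

eqF-true⁺ : ∀ {n} {a b : Fin n} → a ≡ b → eqF a b ≡ true
eqF-true⁺ {a = a} {b} = isYes-true⁺ (a ≟ b)

eqF-refl : ∀ {n} (a : Fin n) → eqF a a ≡ true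
eqF-refl a = eqF-true⁺ refl

eqF-false : ∀ {n} {a b : Fin n} → a ≢ b → eqF a b ≡ false
eqF-false {a = a} {b} = isYes-false⁺ (a ≟ b)

eqF-sym : ∀ {n} (a b : Fin n) → eqF a b ≡ eqF b a
eqF-sym a b = bool-ext (eqF-true⁺ ∘ ≡.sym ∘ eqF-true⁻) (eqF-true⁺ ∘ ≡.sym ∘ eqF-true⁻)

eqF-injective : ∀ {k l} (f : Fin k → Fin l) → (∀ {a b} → f a ≡ f b → a ≡ b) →
                ∀ a b → eqF (f a) (f b) ≡ eqF a b
eqF-injective f f-inj a b = bool-ext (eqF-true⁺ ∘ f-inj ∘ eqF-true⁻) (eqF-true⁺ ∘ cong f ∘ eqF-true⁻)

eqF-∧-subst : ∀ {n} (f : Fin n → Bool) (a b : Fin n) → eqF a b ∧ f a ≡ eqF a b ∧ f b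
eqF-∧-subst f a b with eqF a b in e
... | true  = cong f (eqF-true⁻ e)
... | false = refl

private variable
  A B : Set

𝟙 : Bool → ℕ
𝟙 b = if b then 1 else 0

∑ : List A → (A → ℕ) → ℕ
∑ []       f = 0
∑ (x ∷ xs) f = f x + ∑ xs f


∑-cong : (xs : List A) {f g : A → ℕ} → (∀ x → f x ≡ g x) → ∑ xs f ≡ ∑ xs g
∑-cong []       e = refl
∑-cong (x ∷ xs) e = cong₂ _+_ (e x) (∑-cong xs e)

∑-mono : (xs : List A) {f g : A → ℕ} → (∀ x → f x ≤ g x) → ∑ xs f ≤ ∑ xs g
∑-mono []       e = z≤n
∑-mono (x ∷ xs) e = +-mono-≤ (e x) (∑-mono xs e)

∑-+ : (xs : List A) (f g : A → ℕ) → ∑ xs (λ x → f x + g x) ≡ ∑ xs f + ∑ xs g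
∑-+ []       f g = refl
∑-+ (x ∷ xs) f g = trans (cong (f x + g x +_) (∑-+ xs f g)) (interchange (f x) (g x) (∑ xs f) (∑ xs g))

∑-zero : (xs : List A) → ∑ xs (λ _ → 0) ≡ 0
∑-zero []       = refl
∑-zero (x ∷ xs) = ∑-zero xs

∑-swap : (xs : List A) (ys : List B) (f : A → B → ℕ) →
         ∑ xs (λ a → ∑ ys (f a)) ≡ ∑ ys (λ b → ∑ xs (λ a → f a b))
∑-swap []       ys f = ≡.sym (∑-zero ys)
∑-swap (x ∷ xs) ys f = trans (cong (∑ ys (f x) +_) (∑-swap xs ys f)) (≡.sym (∑-+ ys (f x) _))

countB-∷ : (p : A → Bool) (x : A) (xs : List A) → countB p (x ∷ xs) ≡ 𝟙 (p x) + countB p xs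
countB-∷ p x xs with p x
... | true  = refl
... | false = refl

∑-𝟙 : (p : A → Bool) (xs : List A) → ∑ xs (𝟙 ∘ p) ≡ countB p xs
∑-𝟙 p []       = refl
∑-𝟙 p (x ∷ xs) = trans (cong (𝟙 (p x) +_) (∑-𝟙 p xs)) (≡.sym (countB-∷ p x xs))

∑-if : (p : A → Bool) (v : ℕ) (xs : List A) → ∑ xs (λ x → if p x then v else 0) ≡ countB p xs * v
∑-if p v []       = refl
∑-if p v (x ∷ xs) with p x
... | true  = cong (v +_) (∑-if p v xs)
... | false = ∑-if p v xs

countB-cong : (xs : List A) {p q : A → Bool} → (∀ x → p x ≡ q x) → countB p xs ≡ countB q xs
countB-cong xs e = trans (≡.sym (∑-𝟙 _ xs)) (trans (∑-cong xs (cong 𝟙 ∘ e)) (∑-𝟙 _ xs))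

countB-mono : (xs : List A) {p q : A → Bool} → (∀ x → p x ≡ true → q x ≡ true) → countB p xs ≤ countB q xs
countB-mono []       h = z≤n
countB-mono (x ∷ xs) {p} {q} h with p x in px | q x in qx
... | true  | true  = s≤s (countB-mono xs h)
... | true  | false = ⊥-elim (≡true⇒≢false (h x px) qx)
... | false | true  = m≤n⇒m≤1+n (countB-mono xs h)
... | false | false = countB-mono xs h

countB-none : (xs : List A) {p : A → Bool} → (∀ x → p x ≡ false) → countB p xs ≡ 0
countB-none xs {p} h = trans (countB-cong xs h) (countB-false xs)
  where
  countB-false : (xs : List A) → countB (λ _ → false) xs ≡ 0
  countB-false []       = refl
  countB-false (x ∷ xs) = countB-false xs

countB-split : (p q : A → Bool) (xs : List A) →
               countB p xs ≡ countB (λ x → p x ∧ q x) xs + countB (λ x → p x ∧ not (q x)) xs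
countB-split p q []       = refl
countB-split p q (x ∷ xs) with p x | q x
... | true  | true  = cong suc (countB-split p q xs)
... | true  | false = trans (cong suc (countB-split p q xs)) (≡.sym (+-suc _ _))
... | false | _     = countB-split p q xs

countB-witness : (p : A → Bool) (xs : List A) {k : ℕ} → countB p xs ≡ suc k → Σ A λ x → p x ≡ true
countB-witness p (x ∷ xs) e with p x in px
... | true  = x , px
... | false = countB-witness p xs e

countB-const-∧ : (b : Bool) (q : A → Bool) (xs : List A) → countB (λ x → b ∧ q x) xs ≡ (if b then countB q xs else 0)
countB-const-∧ true  q xs = refl
countB-const-∧ false q xs = countB-none xs (λ _ → refl)

countB-∧-constant : (p q : A → Bool) (b : Bool) (xs : List A) → (∀ x → p x ≡ true → q x ≡ b) →
                    countB (λ x → p x ∧ q x) xs ≡ (if b then countB p xs else 0)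
countB-∧-constant p q b xs h = trans (countB-cong xs pointwise) (countB-const-∧ b p xs)
  where
  pointwise : ∀ x → p x ∧ q x ≡ b ∧ p x
  pointwise x with p x in px
  ... | true  = trans (h x px) (≡.sym (∧-identityʳ b))
  ... | false = ≡.sym (∧-zeroʳ b)

countB-swap : (r : A → B → Bool) (xs : List A) (ys : List B) →
              ∑ xs (λ a → countB (r a) ys) ≡ ∑ ys (λ b → countB (λ a → r a b) xs)
countB-swap r xs ys = begin
  ∑ xs (λ a → countB (r a) ys)                ≡⟨ ∑-cong xs (λ a → ≡.sym (∑-𝟙 (r a) ys)) ⟩
  ∑ xs (λ a → ∑ ys (λ b → 𝟙 (r a b)))         ≡⟨ ∑-swap xs ys (λ a b → 𝟙 (r a b)) ⟩
  ∑ ys (λ b → ∑ xs (λ a → 𝟙 (r a b)))         ≡⟨ ∑-cong ys (λ b → ∑-𝟙 (λ a → r a b) xs) ⟩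
  ∑ ys (λ b → countB (λ a → r a b) xs)        ∎
  where open ≡-Reasoning

countB-double : (p : A → Bool) (q : B → Bool) (r : A → B → Bool) (xs : List A) (ys : List B) →
                (∀ a → countB (r a) ys ≡ 𝟙 (p a)) → (∀ b → countB (λ a → r a b) xs ≡ 𝟙 (q b)) →
                countB p xs ≡ countB q ys
countB-double p q r xs ys fibreˡ fibreʳ = begin
  countB p xs                           ≡⟨ ≡.sym (∑-𝟙 p xs) ⟩
  ∑ xs (𝟙 ∘ p)                          ≡⟨ ∑-cong xs (≡.sym ∘ fibreˡ) ⟩
  ∑ xs (λ a → countB (r a) ys)          ≡⟨ countB-swap r xs ys ⟩
  ∑ ys (λ b → countB (λ a → r a b) xs)  ≡⟨ ∑-cong ys fibreʳ ⟩
  ∑ ys (𝟙 ∘ q)                          ≡⟨ ∑-𝟙 q ys ⟩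
  countB q ys                           ∎
  where open ≡-Reasoning

countB-≤1 : (p : A → Bool) (xs : List A) → Unique xs → (∀ a b → p a ≡ true → p b ≡ true → a ≡ b) →
            countB p xs ≤ 1
countB-≤1 p []       _            _   = z≤n
countB-≤1 p (x ∷ xs) (x∉xs ∷ uniq) p-once with p x in px
... | false = countB-≤1 p xs uniq p-once
... | true  = s≤s (≤-reflexive (none-after xs x∉xs))
  where
  none-after : ∀ ys → All (x ≢_) ys → countB p ys ≡ 0
  none-after []       []           = refl
  none-after (y ∷ ys) (x≢y ∷ x∉ys) with p y in py
  ... | true  = ⊥-elim (x≢y (p-once x y px py))
  ... | false = none-after ys x∉ys

countB-map : (p : B → Bool) (f : A → B) (xs : List A) → countB p (map f xs) ≡ countB (p ∘ f) xs
countB-map p f []       = refl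
countB-map p f (x ∷ xs) with p (f x)
... | true  = cong suc (countB-map p f xs)
... | false = countB-map p f xs

countB-++ : (p : A → Bool) (xs ys : List A) → countB p (xs ++ ys) ≡ countB p xs + countB p ys
countB-++ p []       ys = refl
countB-++ p (x ∷ xs) ys with p x
... | true  = cong suc (countB-++ p xs ys)
... | false = countB-++ p xs ys

countB-concatMap : (p : B → Bool) (f : A → List B) (xs : List A) →
                   countB p (concatMap f xs) ≡ ∑ xs (countB p ∘ f)
countB-concatMap p f []       = refl
countB-concatMap p f (x ∷ xs) =
  trans (countB-++ p (f x) (concatMap f xs)) (cong (countB p (f x) +_) (countB-concatMap p f xs))

countB-tabulate : (p : A → Bool) {n : ℕ} (f : Fin n → A) → countB p (tabulate f) ≡ countB (p ∘ f) (allFin n)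
countB-tabulate p {zero}  f = refl
countB-tabulate p {suc n} f with p (f zero)
... | true  = cong suc (trans (countB-tabulate p (f ∘ suc)) (≡.sym (countB-tabulate (p ∘ f) suc)))
... | false = trans (countB-tabulate p (f ∘ suc)) (≡.sym (countB-tabulate (p ∘ f) suc))

countB-allFin-suc : {n : ℕ} (p : Fin (suc n) → Bool) → countB p (allFin (suc n)) ≡ 𝟙 (p zero) + countB (p ∘ suc) (allFin n)
countB-allFin-suc {n} p = trans (countB-∷ p zero (tabulate suc)) (cong (𝟙 (p zero) +_) (countB-tabulate p {n} suc))

∑-tabulate : {n : ℕ} (f : Fin n → A) (h : A → ℕ) → ∑ (tabulate f) h ≡ ∑ (allFin n) (h ∘ f)
∑-tabulate {n = zero}  f h = refl
∑-tabulate {n = suc n} f h = cong (h (f zero) +_) (trans (∑-tabulate (f ∘ suc) h) (≡.sym (∑-tabulate suc (h ∘ f))))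

∑-allFin-suc : {n : ℕ} (h : Fin (suc n) → ℕ) → ∑ (allFin (suc n)) h ≡ h zero + ∑ (allFin n) (h ∘ suc)
∑-allFin-suc {n} h = cong (h zero +_) (∑-tabulate {n = n} suc h)

∑-const : (n k : ℕ) → ∑ (allFin n) (λ _ → k) ≡ n * k
∑-const zero    k = refl
∑-const (suc n) k = trans (∑-allFin-suc {n} (λ _ → k)) (cong (k +_) (∑-const n k))

h≤1⇒∑≤n : (n : ℕ) (h : Fin n → ℕ) → (∀ u → h u ≤ 1) → ∑ (allFin n) h ≤ n
h≤1⇒∑≤n n h h≤1 = ≤-trans (∑-mono (allFin n) h≤1) (≤-reflexive (trans (∑-const n 1) (*-identityʳ n)))

h≤1∧∑≡n⇒h≡1 : (n : ℕ) (h : Fin n → ℕ) → (∀ u → h u ≤ 1) → ∑ (allFin n) h ≡ n → ∀ u → h u ≡ 1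
h≤1∧∑≡n⇒h≡1 (suc n) h h≤1 ∑≡n = by-head (h zero) refl (h≤1 zero) (trans (≡.sym (∑-allFin-suc {n} h)) ∑≡n)
  where
  by-head : ∀ a → a ≡ h zero → a ≤ 1 → a + ∑ (allFin n) (h ∘ suc) ≡ suc n → ∀ u → h u ≡ 1
  by-head 0 _ _ e = ⊥-elim (1+n≰n (≤-trans (≤-reflexive (≡.sym e)) (h≤1⇒∑≤n n (h ∘ suc) (h≤1 ∘ suc))))
  by-head 1 h0 _ e zero    = ≡.sym h0
  by-head 1 h0 _ e (suc u) = h≤1∧∑≡n⇒h≡1 n (h ∘ suc) (h≤1 ∘ suc) (suc-injective′ e) u
  by-head (suc (suc _)) _ (s≤s ()) _

countB-eqF-allFin : {n : ℕ} (y : Fin n) → countB (λ i → eqF i y) (allFin n) ≡ 1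
countB-eqF-allFin {suc n} zero =
  trans (countB-allFin-suc {n} (λ i → eqF i zero)) (cong suc (countB-none (allFin n) (λ _ → refl)))
countB-eqF-allFin {suc n} (suc y) =
  trans (countB-allFin-suc {n} (λ i → eqF i (suc y)))
        (trans (countB-cong (allFin n) (λ i → eqF-injective suc suc-injective i y)) (countB-eqF-allFin y))

countB-fibres : {k : ℕ} (p : A → Bool) (f : A → Fin k) (xs : List A) →
                countB p xs ≡ ∑ (allFin k) (λ u → countB (λ x → p x ∧ eqF (f x) u) xs)
countB-fibres {k = k} p f xs = begin
  countB p xs                                              ≡⟨ ≡.sym (∑-𝟙 p xs) ⟩
  ∑ xs (𝟙 ∘ p)                                             ≡⟨ ∑-cong xs (≡.sym ∘ fibre) ⟩
  ∑ xs (λ x → countB (λ u → p x ∧ eqF (f x) u) (allFin k)) ≡⟨ countB-swap (λ x u → p x ∧ eqF (f x) u) xs (allFin k) ⟩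
  ∑ (allFin k) (λ u → countB (λ x → p x ∧ eqF (f x) u) xs) ∎
  where
  open ≡-Reasoning
  fibre : ∀ x → countB (λ u → p x ∧ eqF (f x) u) (allFin k) ≡ 𝟙 (p x)
  fibre x with p x
  ... | true  = trans (countB-cong (allFin k) (eqF-sym (f x))) (countB-eqF-allFin (f x))
  ... | false = countB-none (allFin k) (λ _ → refl)

countB-allFuns-suc : (xs : List A) {N : ℕ} (φ : (Fin (suc N) → A) → Bool) →
  countB φ (allFuns xs (suc N)) ≡ ∑ xs (λ a → countB (φ ∘ (a ∷ᶠ_)) (allFuns xs N))
countB-allFuns-suc xs {N} φ =
  trans (countB-concatMap φ (λ a → map (a ∷ᶠ_) (allFuns xs N)) xs)
        (∑-cong xs (λ a → countB-map φ (a ∷ᶠ_) (allFuns xs N)))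

Extensional : {N : ℕ} → ((Fin N → A) → Bool) → Set _
Extensional φ = ∀ {g h} → g ≗ h → φ g ≡ φ h

agree : DecidableEquality A → {N : ℕ} → (Fin N → A) → (Fin N → A) → Bool
agree _≟ₐ_ {zero}  g h = true
agree _≟ₐ_ {suc N} g h = ⌊ g zero ≟ₐ h zero ⌋ ∧ agree _≟ₐ_ (g ∘ suc) (h ∘ suc)

module _ (_≟ₐ_ : DecidableEquality A) where

  agree-true⁻ : {N : ℕ} (g h : Fin N → A) → agree _≟ₐ_ g h ≡ true → g ≗ h
  agree-true⁻ g h e zero    = isYes-true⁻ (g zero ≟ₐ h zero) (∧-true⁻ˡ e)
  agree-true⁻ g h e (suc i) = agree-true⁻ (g ∘ suc) (h ∘ suc) (∧-true⁻ʳ {⌊ g zero ≟ₐ h zero ⌋} e) i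

  agree-true⁺ : {N : ℕ} (g h : Fin N → A) → g ≗ h → agree _≟ₐ_ g h ≡ true
  agree-true⁺ {zero}  g h e = refl
  agree-true⁺ {suc N} g h e =
    ∧-true⁺ (isYes-true⁺ (g zero ≟ₐ h zero) (e zero)) (agree-true⁺ (g ∘ suc) (h ∘ suc) (e ∘ suc))

  countB-agree-allFuns : (xs : List A) → (∀ a → countB (λ c → ⌊ c ≟ₐ a ⌋) xs ≡ 1) →
                         (N : ℕ) (g : Fin N → A) → countB (λ h → agree _≟ₐ_ h g) (allFuns xs N) ≡ 1
  countB-agree-allFuns xs once zero    g = refl
  countB-agree-allFuns xs once (suc N) g = begin
    countB (λ h → agree _≟ₐ_ h g) (allFuns xs (suc N))
      ≡⟨ countB-allFuns-suc xs (λ h → agree _≟ₐ_ h g) ⟩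
    ∑ xs (λ a → countB (λ h → ⌊ a ≟ₐ g zero ⌋ ∧ agree _≟ₐ_ h (g ∘ suc)) (allFuns xs N))
      ≡⟨ ∑-cong xs (λ a → countB-const-∧ ⌊ a ≟ₐ g zero ⌋ _ (allFuns xs N)) ⟩
    ∑ xs (λ a → if ⌊ a ≟ₐ g zero ⌋ then countB (λ h → agree _≟ₐ_ h (g ∘ suc)) (allFuns xs N) else 0)
      ≡⟨ ∑-cong xs (λ a → cong (λ c → if ⌊ a ≟ₐ g zero ⌋ then c else 0) (countB-agree-allFuns xs once N (g ∘ suc))) ⟩
    ∑ xs (λ a → 𝟙 ⌊ a ≟ₐ g zero ⌋)
      ≡⟨ ∑-𝟙 (λ a → ⌊ a ≟ₐ g zero ⌋) xs ⟩
    countB (λ a → ⌊ a ≟ₐ g zero ⌋) xs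
      ≡⟨ once (g zero) ⟩
    1 ∎
    where open ≡-Reasoning

  countB-agree-∧ : (xs : List A) → (∀ a → countB (λ c → ⌊ c ≟ₐ a ⌋) xs ≡ 1) →
                   (N : ℕ) (g : Fin N → A) (φ : (Fin N → A) → Bool) → Extensional φ →
                   countB (λ h → agree _≟ₐ_ h g ∧ φ h) (allFuns xs N) ≡ 𝟙 (φ g)
  countB-agree-∧ xs once N g φ φ-ext =
    trans (countB-∧-constant _ φ (φ g) (allFuns xs N) (λ h e → φ-ext (agree-true⁻ h g e)))
          (cong (λ c → if φ g then c else 0) (countB-agree-allFuns xs once N g))

allB-tabulate : (p : A → Bool) {n : ℕ} (f : Fin n → A) → allB p (tabulate f) ≡ allB (p ∘ f) (allFin n)
allB-tabulate p {zero}  f = refl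
allB-tabulate p {suc n} f = cong (p (f zero) ∧_) (trans (allB-tabulate p (f ∘ suc)) (≡.sym (allB-tabulate (p ∘ f) suc)))

allB-allFin⁻ : {n : ℕ} (p : Fin n → Bool) → allB p (allFin n) ≡ true → ∀ i → p i ≡ true
allB-allFin⁻ {suc n} p h zero    = ∧-true⁻ˡ h
allB-allFin⁻ {suc n} p h (suc i) =
  allB-allFin⁻ (p ∘ suc) (trans (≡.sym (allB-tabulate p {n} suc)) (∧-true⁻ʳ {p zero} h)) i

allB-allFin⁺ : {n : ℕ} (p : Fin n → Bool) → (∀ i → p i ≡ true) → allB p (allFin n) ≡ true
allB-allFin⁺ {zero}  p h = refl
allB-allFin⁺ {suc n} p h = ∧-true⁺ (h zero) (trans (allB-tabulate p {n} suc) (allB-allFin⁺ (p ∘ suc) (h ∘ suc)))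

IsIndependent : (K : Graph) → (Fin (n K) → Bool) → Set
IsIndependent K S = ∀ x y → S x ≡ true → S y ≡ true → adj K x y ≡ false

independent-true⁻ : (K : Graph) (S : Fin (n K) → Bool) → independent K S ≡ true → IsIndependent K S
independent-true⁻ K S h x y Sx Sy = nand (allB-allFin⁻ _ (allB-allFin⁻ _ h x) y) Sx Sy
  where
  nand : ∀ {a b c} → not (a ∧ b ∧ c) ≡ true → a ≡ true → b ≡ true → c ≡ false
  nand h refl refl = not-true⁻ h

independent-true⁺ : (K : Graph) (S : Fin (n K) → Bool) → IsIndependent K S → independent K S ≡ true
independent-true⁺ K S h = allB-allFin⁺ _ (λ x → allB-allFin⁺ _ (λ y → nand (S x) (S y) (h x y)))
  where
  nand : ∀ a b {c} → (a ≡ true → b ≡ true → c ≡ false) → not (a ∧ b ∧ c) ≡ true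
  nand true  true  h = cong not (h refl refl)
  nand true  false h = refl
  nand false b     h = refl

independent-cong : (K : Graph) {S S′ : Fin (n K) → Bool} → S ≗ S′ → independent K S ≡ independent K S′
independent-cong K {S} {S′} e = bool-ext
  (λ h → independent-true⁺ K S′ λ x y Sx Sy →
           independent-true⁻ K S h x y (trans (e x) Sx) (trans (e y) Sy))
  (λ h → independent-true⁺ K S λ x y Sx Sy →
           independent-true⁻ K S′ h x y (trans (≡.sym (e x)) Sx) (trans (≡.sym (e y)) Sy))

IsProper : (K : Graph) {k : ℕ} → (Fin (n K) → Fin k) → Set
IsProper K g = ∀ i j → adj K i j ≡ true → eqF (g i) (g j) ≡ false

proper-true⁻ : (K : Graph) {k : ℕ} (g : Fin (n K) → Fin k) → proper K g ≡ true → IsProper K g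
proper-true⁻ K g h i j a = nor (allB-allFin⁻ _ (allB-allFin⁻ _ h i) j) a
  where
  nor : ∀ {a b} → not a ∨ not b ≡ true → a ≡ true → b ≡ false
  nor h refl = not-true⁻ h

proper-true⁺ : (K : Graph) {k : ℕ} (g : Fin (n K) → Fin k) → IsProper K g → proper K g ≡ true
proper-true⁺ K g h = allB-allFin⁺ _ (λ i → allB-allFin⁺ _ (λ j → nor (adj K i j) (h i j)))
  where
  nor : ∀ a {b} → (a ≡ true → b ≡ false) → not a ∨ not b ≡ true
  nor true  h = cong not (h refl)
  nor false h = refl

Bools : List Bool
Bools = true ∷ false ∷ []

subsets : (N : ℕ) → List (Fin N → Bool)
subsets = allFuns Bools

countB-subsets-suc : {N : ℕ} (φ : (Fin (suc N) → Bool) → Bool) →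
  countB φ (subsets (suc N)) ≡ countB (φ ∘ (true ∷ᶠ_)) (subsets N) + countB (φ ∘ (false ∷ᶠ_)) (subsets N)
countB-subsets-suc {N} φ =
  trans (countB-allFuns-suc Bools φ) (cong (countB (φ ∘ (true ∷ᶠ_)) (subsets N) +_) (+-identityʳ _))

size-suc : {N : ℕ} (S : Fin (suc N) → Bool) → size S ≡ 𝟙 (S zero) + size (S ∘ suc)
size-suc S = countB-allFin-suc S

insert : {N : ℕ} → (Fin N → Bool) → Fin N → Fin N → Bool
insert S zero    = true ∷ᶠ (S ∘ suc)
insert S (suc x) = S zero ∷ᶠ insert (S ∘ suc) x

insert-other : {N : ℕ} (S : Fin N → Bool) (x i : Fin N) → i ≢ x → insert S x i ≡ S i
insert-other S zero    zero    i≢x = ⊥-elim (i≢x refl)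
insert-other S zero    (suc i) i≢x = refl
insert-other S (suc x) zero    i≢x = refl
insert-other S (suc x) (suc i) i≢x = insert-other (S ∘ suc) x i (i≢x ∘ cong suc)

size-insert : {N : ℕ} (S : Fin N → Bool) (x : Fin N) → S x ≡ false → size (insert S x) ≡ suc (size S)
size-insert {suc N} S zero    Sx =
  trans (size-suc (insert S zero)) (cong suc (≡.sym (trans (size-suc S) (cong (λ b → 𝟙 b + size (S ∘ suc)) Sx))))
size-insert {suc N} S (suc x) Sx = begin
  size (insert S (suc x))                 ≡⟨ size-suc (insert S (suc x)) ⟩
  𝟙 (S zero) + size (insert (S ∘ suc) x)  ≡⟨ cong (𝟙 (S zero) +_) (size-insert (S ∘ suc) x Sx) ⟩
  𝟙 (S zero) + suc (size (S ∘ suc))       ≡⟨ +-suc _ _ ⟩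
  suc (𝟙 (S zero) + size (S ∘ suc))       ≡⟨ cong suc (≡.sym (size-suc S)) ⟩
  suc (size S)                            ∎
  where open ≡-Reasoning

countB-containing : {N : ℕ} (φ : (Fin N → Bool) → Bool) (x : Fin N) →
  countB (λ S → S x ∧ φ S) (subsets N) ≡ countB (λ S → not (S x) ∧ φ (insert S x)) (subsets N)
countB-containing {suc N} φ zero =
  trans (countB-subsets-suc (λ S → S zero ∧ φ S))
        (trans (+-comm (countB (φ ∘ (true ∷ᶠ_)) (subsets N)) _)
               (≡.sym (countB-subsets-suc (λ S → not (S zero) ∧ φ (insert S zero)))))
countB-containing {suc N} φ (suc x) =
  trans (countB-subsets-suc (λ S → S (suc x) ∧ φ S))
        (trans (cong₂ _+_ (countB-containing (φ ∘ (true ∷ᶠ_)) x) (countB-containing (φ ∘ (false ∷ᶠ_)) x))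
               (≡.sym (countB-subsets-suc (λ S → not (S (suc x)) ∧ φ (insert S (suc x))))))

card : {N : ℕ} → (Fin N → Bool) → ℕ
card {zero}  T = 0
card {suc N} T = 𝟙 (T zero) + card (T ∘ suc)

embed-∷ : (b : Bool) {k N : ℕ} → (Fin k → Fin N) → Fin (𝟙 b + k) → Fin (suc N)
embed-∷ true  f zero    = zero
embed-∷ true  f (suc j) = suc (f j)
embed-∷ false f j       = suc (f j)

embed : {N : ℕ} (T : Fin N → Bool) → Fin (card T) → Fin N
embed {suc N} T = embed-∷ (T zero) (embed (T ∘ suc))

extend-∷ : (b : Bool) {k N : ℕ} → ((Fin k → Bool) → Fin N → Bool) → (Fin (𝟙 b + k) → Bool) → Fin (suc N) → Bool
extend-∷ true  e S = S zero ∷ᶠ e (S ∘ suc)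
extend-∷ false e S = false ∷ᶠ e S

extend : {N : ℕ} (T : Fin N → Bool) → (Fin (card T) → Bool) → Fin N → Bool
extend {zero}  T S = S
extend {suc N} T   = extend-∷ (T zero) (extend (T ∘ suc))

embed-∈ : {N : ℕ} (T : Fin N → Bool) (j : Fin (card T)) → T (embed T j) ≡ true
embed-∈ {suc N} T j with T zero in T0
embed-∈ {suc N} T zero    | true  = T0
embed-∈ {suc N} T (suc j) | true  = embed-∈ (T ∘ suc) j
embed-∈ {suc N} T j       | false = embed-∈ (T ∘ suc) j

embed-injective : {N : ℕ} (T : Fin N → Bool) {j j′ : Fin (card T)} → embed T j ≡ embed T j′ → j ≡ j′
embed-injective {suc N} T {j} {j′} e with T zero
embed-injective {suc N} T {zero}  {zero}   e | true  = refl
embed-injective {suc N} T {suc j} {suc j′} e | true  = cong suc (embed-injective (T ∘ suc) (suc-injective e))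
embed-injective {suc N} T {j}     {j′}     e | false = embed-injective (T ∘ suc) (suc-injective e)

extend-embed : {N : ℕ} (T : Fin N → Bool) (S : Fin (card T) → Bool) (j : Fin (card T)) → extend T S (embed T j) ≡ S j
extend-embed {suc N} T S j with T zero
extend-embed {suc N} T S zero    | true  = refl
extend-embed {suc N} T S (suc j) | true  = extend-embed (T ∘ suc) (S ∘ suc) j
extend-embed {suc N} T S j       | false = extend-embed (T ∘ suc) S j

extend-true⁻ : {N : ℕ} (T : Fin N → Bool) (S : Fin (card T) → Bool) (i : Fin N) →
               extend T S i ≡ true → Σ (Fin (card T)) λ j → embed T j ≡ i
extend-true⁻ {suc N} T S i e with T zero
extend-true⁻ {suc N} T S zero    e | true  = zero , refl
extend-true⁻ {suc N} T S (suc i) e | true  with extend-true⁻ (T ∘ suc) (S ∘ suc) i e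
... | j , refl = suc j , refl
extend-true⁻ {suc N} T S (suc i) e | false with extend-true⁻ (T ∘ suc) S i e
... | j , refl = j , refl

size-extend : {N : ℕ} (T : Fin N → Bool) (S : Fin (card T) → Bool) → size (extend T S) ≡ size S
size-extend {zero}  T S = refl
size-extend {suc N} T S with T zero
... | true  = trans (size-suc (extend-∷ true (extend (T ∘ suc)) S))
                    (trans (cong (𝟙 (S zero) +_) (size-extend (T ∘ suc) (S ∘ suc))) (≡.sym (size-suc S)))
... | false = trans (size-suc (extend-∷ false (extend (T ∘ suc)) S)) (size-extend (T ∘ suc) S)

countB-embed : {N : ℕ} (T : Fin N → Bool) (q : Fin N → Bool) →
               countB (q ∘ embed T) (allFin (card T)) ≡ countB (λ i → T i ∧ q i) (allFin N)
countB-embed {zero}  T q = refl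
countB-embed {suc N} T q = trans split-head (≡.sym (countB-allFin-suc (λ i → T i ∧ q i)))
  where
  split-head : countB (q ∘ embed T) (allFin (card T))
               ≡ 𝟙 (T zero ∧ q zero) + countB (λ i → T (suc i) ∧ q (suc i)) (allFin N)
  split-head with T zero
  ... | true  = trans (countB-allFin-suc (q ∘ embed-∷ true (embed (T ∘ suc))))
                      (cong (𝟙 (q zero) +_) (countB-embed (T ∘ suc) (q ∘ suc)))
  ... | false = countB-embed (T ∘ suc) (q ∘ suc)

_⊆ᵇ_ : {N : ℕ} → (Fin N → Bool) → (Fin N → Bool) → Bool
_⊆ᵇ_ {zero}  S T = true
_⊆ᵇ_ {suc N} S T = (not (S zero) ∨ T zero) ∧ ((S ∘ suc) ⊆ᵇ (T ∘ suc))

⊆ᵇ-true⁻ : {N : ℕ} (S T : Fin N → Bool) → S ⊆ᵇ T ≡ true → ∀ i → S i ≡ true → T i ≡ true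
⊆ᵇ-true⁻ S T h zero Si with S zero | T zero | h
... | true | true | _ = refl
⊆ᵇ-true⁻ S T h (suc i) Si = ⊆ᵇ-true⁻ (S ∘ suc) (T ∘ suc) (∧-true⁻ʳ {not (S zero) ∨ T zero} h) i Si

countB-⊆ᵇ : {N : ℕ} (T : Fin N → Bool) (φ : (Fin N → Bool) → Bool) →
            countB (λ S → S ⊆ᵇ T ∧ φ S) (subsets N) ≡ countB (φ ∘ extend T) (subsets (card T))
countB-⊆ᵇ {zero}  T φ = refl
countB-⊆ᵇ {suc N} T φ = trans (countB-subsets-suc (λ S → S ⊆ᵇ T ∧ φ S)) split-head
  where
  split-head : countB (λ S → (true ∷ᶠ S) ⊆ᵇ T ∧ φ (true ∷ᶠ S)) (subsets N)
               + countB (λ S → (false ∷ᶠ S) ⊆ᵇ T ∧ φ (false ∷ᶠ S)) (subsets N)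
               ≡ countB (φ ∘ extend T) (subsets (card T))
  split-head with T zero
  ... | true  = trans (cong₂ _+_ (countB-⊆ᵇ (T ∘ suc) (φ ∘ (true ∷ᶠ_))) (countB-⊆ᵇ (T ∘ suc) (φ ∘ (false ∷ᶠ_))))
                      (≡.sym (countB-subsets-suc (φ ∘ extend-∷ true (extend (T ∘ suc)))))
  ... | false = cong₂ _+_ (countB-none (subsets N) (λ _ → refl)) (countB-⊆ᵇ (T ∘ suc) (φ ∘ (false ∷ᶠ_)))

induced : (K : Graph) → (Fin (n K) → Bool) → Graph
induced K T = record
  { n      = card T
  ; adj    = λ a b → adj K (embed T a) (embed T b)
  ; sym    = λ a b → Graph.sym K (embed T a) (embed T b)
  ; irrefl = λ a → irrefl K (embed T a)
  }

independent-induced : (K : Graph) (T : Fin (n K) → Bool) (S : Fin (card T) → Bool) →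
                      independent (induced K T) S ≡ independent K (extend T S)
independent-induced K T S = bool-ext
  (λ h → independent-true⁺ K (extend T S) (lift h))
  (λ h → independent-true⁺ (induced K T) S λ j j′ Sj Sj′ →
     independent-true⁻ K (extend T S) h (embed T j) (embed T j′)
       (trans (extend-embed T S j) Sj) (trans (extend-embed T S j′) Sj′))
  where
  lift : independent (induced K T) S ≡ true → IsIndependent K (extend T S)
  lift h x y Sx Sy with extend-true⁻ T S x Sx | extend-true⁻ T S y Sy
  ... | j , refl | j′ , refl =
    independent-true⁻ (induced K T) S h j j′
      (trans (≡.sym (extend-embed T S j)) Sx) (trans (≡.sym (extend-embed T S j′)) Sy)

independentOfSize : (K : Graph) → ℕ → (Fin (n K) → Bool) → Bool
independentOfSize K k S = independent K S ∧ ⌊ size S ℕ.≟ k ⌋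

independent-own-injective : {K : Graph} (𝓗 : Cover K) (S : Fin (n (H 𝓗)) → Bool) → IsIndependent (H 𝓗) S →
                            ∀ a b → S a ≡ true → S b ≡ true → own 𝓗 a ≡ own 𝓗 b → a ≡ b
independent-own-injective 𝓗 S S-independent a b Sa Sb same with a ≟ b
... | yes a≡b = a≡b
... | no  a≢b = ⊥-elim (≡true⇒≢false (clique 𝓗 a b a≢b same) (S-independent a b Sa Sb))

-- Restricting a cover of K₁ ∨ G to a cover of G

module Restriction (G : Graph) (𝓗 : Cover (join1 G)) (T : Fin (n (H 𝓗)) → Bool)
                   (T-nonapex : ∀ i → T i ≡ true → own 𝓗 i ≢ zero) where

  N : ℕ
  N = n (H 𝓗)

  own′ : Fin (card T) → Fin (n G)
  own′ j = punchOut (T-nonapex (embed T j) (embed-∈ T j) ∘ ≡.sym)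

  suc-own′ : ∀ j → suc (own′ j) ≡ own 𝓗 (embed T j)
  suc-own′ j = punchIn-punchOut (T-nonapex (embed T j) (embed-∈ T j) ∘ ≡.sym)

  own′-≡ : ∀ {j j′} → own′ j ≡ own′ j′ → own 𝓗 (embed T j) ≡ own 𝓗 (embed T j′)
  own′-≡ {j} {j′} e = trans (≡.sym (suc-own′ j)) (trans (cong suc e) (suc-own′ j′))

  own′-≢ : ∀ {j j′} → own′ j ≢ own′ j′ → own 𝓗 (embed T j) ≢ own 𝓗 (embed T j′)
  own′-≢ {j} {j′} ne e = ne (suc-injective (trans (suc-own′ j) (trans e (≡.sym (suc-own′ j′)))))

  cover : Cover G
  cover = record
    { H        = induced (H 𝓗) T
    ; own      = own′
    ; clique   = λ a b a≢b e → clique 𝓗 (embed T a) (embed T b) (a≢b ∘ embed-injective T) (own′-≡ e)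
    ; overEdge = λ a b ab a≢b → subst₂ (λ u v → adj (join1 G) u v ≡ true) (≡.sym (suc-own′ a)) (≡.sym (suc-own′ b))
                                  (overEdge 𝓗 (embed T a) (embed T b) ab (own′-≢ a≢b))
    ; matching = λ a b b′ a≢b b≡b′ ab ab′ → embed-injective T
                   (matching 𝓗 (embed T a) (embed T b) (embed T b′) (own′-≢ a≢b) (own′-≡ b≡b′) ab ab′)
    }

  partSize-cover : ∀ u → partSize cover u ≡ countB (λ i → T i ∧ eqF (own 𝓗 i) (suc u)) (allFin N)
  partSize-cover u =
    trans (countB-cong (allFin (card T)) (λ j → trans (≡.sym (eqF-injective suc suc-injective (own′ j) u))
                                                       (cong (λ v → eqF v (suc u)) (suc-own′ j))))
          (countB-embed T (λ i → eqF (own 𝓗 i) (suc u)))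

  numColourings-cover : numColourings cover ≡ countB (λ S → S ⊆ᵇ T ∧ independentOfSize (H 𝓗) (n G) S) (subsets N)
  numColourings-cover =
    trans (countB-cong (subsets (card T)) (λ S → cong₂ _∧_ (independent-induced (H 𝓗) T S)
                                                          (cong (λ s → ⌊ s ℕ.≟ n G ⌋) (≡.sym (size-extend T S)))))
          (≡.sym (countB-⊆ᵇ T (independentOfSize (H 𝓗) (n G))))

-- Colourings through a vertex of the apex part

module ColouringsThrough (G : Graph) (m : ℕ) (𝓗 : Cover (join1 G)) (𝓗-fold : IsMFold 𝓗 (suc m))
                         (x : Fin (n (H 𝓗))) (x-apex : own 𝓗 x ≡ zero) where

  N : ℕ
  N = n (H 𝓗)

  Partner : Fin (n G) → Set
  Partner u = Σ (Fin N) λ y → own 𝓗 y ≡ suc u × (∀ y′ → own 𝓗 y′ ≡ suc u → adj (H 𝓗) x y′ ≡ true → y′ ≡ y)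

  -- The neighbour of x in L(u+1), unique by the matching condition; any vertex of L(u+1) if x has none there.
  partner : ∀ u → Partner u
  partner u with any? (λ y → (own 𝓗 y ≟ suc u) ×-dec (adj (H 𝓗) x y Bool.≟ true))
  ... | yes (y , y∈ , xy) =
    y , y∈ , λ y′ y′∈ xy′ →
      ≡.sym (matching 𝓗 x y y′ (λ e → 0≢1+n (trans (≡.sym x-apex) (trans e y∈))) (trans y∈ (≡.sym y′∈)) xy xy′)
  ... | no none with countB-witness (λ z → eqF (own 𝓗 z) (suc u)) (allFin N) (𝓗-fold (suc u))
  ...   | y , y∈ = y , eqF-true⁻ y∈ , λ y′ y′∈ xy′ → ⊥-elim (none (y′ , y′∈ , xy′))

  keep : Fin (suc (n G)) → Fin N → Bool
  keep zero    i = false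
  keep (suc u) i = not (eqF i (proj₁ (partner u)))

  T : Fin N → Bool
  T i = keep (own 𝓗 i) i

  T-nonapex : ∀ i → T i ≡ true → own 𝓗 i ≢ zero
  T-nonapex i Ti e = ≡true⇒≢false Ti (cong (λ a → keep a i) e)

  x∉T : T x ≡ false
  x∉T = cong (λ a → keep a x) x-apex

  neighbour∉T : ∀ y → adj (H 𝓗) x y ≡ true → T y ≡ false
  neighbour∉T y xy with own 𝓗 y in y∈
  ... | zero  = refl
  ... | suc u = cong not (eqF-true⁺ (proj₂ (proj₂ (partner u)) y y∈ xy))

  open Restriction G 𝓗 T T-nonapex using (cover; partSize-cover; numColourings-cover)

  cover-fold : IsMFold cover m
  cover-fold u = suc-injective′ (trans (≡.sym split) (𝓗-fold (suc u)))
    where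
    y = proj₁ (partner u)
    inPart : Fin N → Bool
    inPart i = eqF (own 𝓗 i) (suc u)
    kept-in-part : ∀ i → T i ∧ inPart i ≡ inPart i ∧ not (eqF i y)
    kept-in-part i with own 𝓗 i
    ... | zero   = refl
    ... | suc u′ with eqF (suc u′) (suc u) in same
    ...   | true with refl ← suc-injective (eqF-true⁻ same) = ∧-identityʳ _
    ...   | false = ∧-zeroʳ _
    y-once : countB (λ i → inPart i ∧ eqF i y) (allFin N) ≡ 1
    y-once = trans (countB-cong (allFin N) (λ i → ∧-comm (inPart i) (eqF i y)))
                   (trans (countB-∧-constant (λ i → eqF i y) inPart true (allFin N)
                            (λ i e → trans (cong inPart (eqF-true⁻ e)) (eqF-true⁺ (proj₁ (proj₂ (partner u))))))
                          (countB-eqF-allFin y))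
    split : countB inPart (allFin N) ≡ suc (partSize cover u)
    split = trans (countB-split inPart (λ i → eqF i y) (allFin N))
                  (cong₂ _+_ y-once (≡.sym (trans (partSize-cover u) (countB-cong (allFin N) kept-in-part))))

  insert-x : ∀ S → S ⊆ᵇ T ∧ independentOfSize (H 𝓗) (n G) S ≡ true →
             not (S x) ∧ independentOfSize (H 𝓗) (suc (n G)) (insert S x) ≡ true
  insert-x S h =
    ∧-true⁺ (cong not x∉S) (∧-true⁺ (independent-true⁺ (H 𝓗) (insert S x) independent-insert) size-insert-x)
    where
    S⊆T : ∀ i → S i ≡ true → T i ≡ true
    S⊆T = ⊆ᵇ-true⁻ S T (∧-true⁻ˡ h)
    S-independent : IsIndependent (H 𝓗) S
    S-independent = independent-true⁻ (H 𝓗) S (∧-true⁻ˡ (∧-true⁻ʳ {S ⊆ᵇ T} h))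
    S-size : size S ≡ n G
    S-size = isYes-true⁻ (size S ℕ.≟ n G) (∧-true⁻ʳ {independent (H 𝓗) S} (∧-true⁻ʳ {S ⊆ᵇ T} h))
    x∉S : S x ≡ false
    x∉S with S x in Sx
    ... | true  = ⊥-elim (≡true⇒≢false (S⊆T x Sx) x∉T)
    ... | false = refl
    x-isolated : ∀ y → S y ≡ true → adj (H 𝓗) x y ≡ false
    x-isolated y Sy with adj (H 𝓗) x y in xy
    ... | true  = ⊥-elim (≡true⇒≢false (S⊆T y Sy) (neighbour∉T y xy))
    ... | false = refl
    from-insert : ∀ {i} → insert S x i ≡ true → i ≢ x → S i ≡ true
    from-insert {i} e i≢x = trans (≡.sym (insert-other S x i i≢x)) e
    independent-insert : IsIndependent (H 𝓗) (insert S x)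
    independent-insert a b Sa Sb with a ≟ x | b ≟ x
    ... | yes refl | yes refl = irrefl (H 𝓗) x
    ... | yes refl | no b≢x   = x-isolated b (from-insert Sb b≢x)
    ... | no a≢x   | yes refl = trans (Graph.sym (H 𝓗) a x) (x-isolated a (from-insert Sa a≢x))
    ... | no a≢x   | no b≢x   = S-independent a b (from-insert Sa a≢x) (from-insert Sb b≢x)
    size-insert-x : ⌊ size (insert S x) ℕ.≟ suc (n G) ⌋ ≡ true
    size-insert-x = isYes-true⁺ (size (insert S x) ℕ.≟ suc (n G)) (trans (size-insert S x x∉S) (cong suc S-size))

  P≤colouringsThrough : (∀ (𝓗′ : Cover G) → IsMFold 𝓗′ m → P G m ≤ numColourings 𝓗′) →
                          P G m ≤ countB (λ S → S x ∧ independentOfSize (H 𝓗) (suc (n G)) S) (subsets N)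
  P≤colouringsThrough P≤ = begin
    P G m
      ≤⟨ P≤ cover cover-fold ⟩
    numColourings cover
      ≡⟨ numColourings-cover ⟩
    countB (λ S → S ⊆ᵇ T ∧ independentOfSize (H 𝓗) (n G) S) (subsets N)
      ≤⟨ countB-mono (subsets N) insert-x ⟩
    countB (λ S → not (S x) ∧ independentOfSize (H 𝓗) (suc (n G)) (insert S x)) (subsets N)
      ≡⟨ ≡.sym (countB-containing (independentOfSize (H 𝓗) (suc (n G))) x) ⟩
    countB (λ S → S x ∧ independentOfSize (H 𝓗) (suc (n G)) S) (subsets N) ∎
    where open ℕ.≤-Reasoning

[1+m]*P≤numColourings : (G : Graph) (m : ℕ) → (∀ (𝓗′ : Cover G) → IsMFold 𝓗′ m → P G m ≤ numColourings 𝓗′) →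
                        (𝓗 : Cover (join1 G)) → IsMFold 𝓗 (suc m) → suc m * P G m ≤ numColourings 𝓗
[1+m]*P≤numColourings G m P≤ 𝓗 𝓗-fold = begin
  suc m * P G m
    ≡⟨ cong (_* P G m) (≡.sym (𝓗-fold zero)) ⟩
  countB apex (allFin N) * P G m
    ≡⟨ ≡.sym (∑-if apex (P G m) (allFin N)) ⟩
  ∑ (allFin N) (λ a → if apex a then P G m else 0)
    ≤⟨ ∑-mono (allFin N) through ⟩
  ∑ (allFin N) (λ a → countB (λ S → apex a ∧ (S a ∧ ψ S)) (subsets N))
    ≡⟨ countB-swap (λ a S → apex a ∧ (S a ∧ ψ S)) (allFin N) (subsets N) ⟩
  ∑ (subsets N) (λ S → countB (λ a → apex a ∧ (S a ∧ ψ S)) (allFin N))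
    ≤⟨ ∑-mono (subsets N) meets-apex-once ⟩
  ∑ (subsets N) (𝟙 ∘ ψ)
    ≡⟨ ∑-𝟙 ψ (subsets N) ⟩
  numColourings 𝓗 ∎
  where
  open ℕ.≤-Reasoning
  N = n (H 𝓗)
  ψ = independentOfSize (H 𝓗) (suc (n G))
  apex : Fin N → Bool
  apex a = eqF (own 𝓗 a) zero

  through : ∀ a → (if apex a then P G m else 0) ≤ countB (λ S → apex a ∧ (S a ∧ ψ S)) (subsets N)
  through a with apex a in a-apex
  ... | true  = ColouringsThrough.P≤colouringsThrough G m 𝓗 𝓗-fold a (eqF-true⁻ a-apex) P≤
  ... | false = z≤n

  meets-apex-once : ∀ S → countB (λ a → apex a ∧ (S a ∧ ψ S)) (allFin N) ≤ 𝟙 (ψ S)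
  meets-apex-once S with ψ S in ψS
  ... | true  = countB-≤1 _ (allFin N) (allFin⁺ N) λ a b ha hb →
                  independent-own-injective 𝓗 S (independent-true⁻ (H 𝓗) S (∧-true⁻ˡ ψS)) a b
                    (∧-true⁻ˡ (∧-true⁻ʳ {apex a} ha)) (∧-true⁻ˡ (∧-true⁻ʳ {apex b} hb))
                    (trans (eqF-true⁻ (∧-true⁻ˡ ha)) (≡.sym (eqF-true⁻ (∧-true⁻ˡ hb))))
  ... | false = ≤-reflexive (countB-none (allFin N) λ a →
                  trans (cong (apex a ∧_) (∧-zeroʳ (S a))) (∧-zeroʳ (apex a)))

-- The chromatic polynomial of K₁ ∨ G

proper-cong : (K : Graph) {k k′ : ℕ} (g : Fin (n K) → Fin k) (g′ : Fin (n K) → Fin k′) →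
              (∀ i j → eqF (g i) (g j) ≡ eqF (g′ i) (g′ j)) → proper K g ≡ proper K g′
proper-cong K g g′ same = bool-ext
  (λ h → proper-true⁺ K g′ λ i j a → trans (≡.sym (same i j)) (proper-true⁻ K g h i j a))
  (λ h → proper-true⁺ K g λ i j a → trans (same i j) (proper-true⁻ K g′ h i j a))

avoids : {N k : ℕ} → Fin k → (Fin N → Fin k) → Bool
avoids {zero}  c g = true
avoids {suc N} c g = not (eqF c (g zero)) ∧ avoids c (g ∘ suc)

avoids-true⁻ : {N k : ℕ} (c : Fin k) (g : Fin N → Fin k) → avoids c g ≡ true → ∀ j → eqF c (g j) ≡ false
avoids-true⁻ c g h zero    = not-true⁻ (∧-true⁻ˡ h)
avoids-true⁻ c g h (suc j) = avoids-true⁻ c (g ∘ suc) (∧-true⁻ʳ {not (eqF c (g zero))} h) j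

avoids-true⁺ : {N k : ℕ} (c : Fin k) (g : Fin N → Fin k) → (∀ j → eqF c (g j) ≡ false) → avoids c g ≡ true
avoids-true⁺ {zero}  c g h = refl
avoids-true⁺ {suc N} c g h = ∧-true⁺ (cong not (h zero)) (avoids-true⁺ c (g ∘ suc) (h ∘ suc))

proper-join1 : (G : Graph) {k : ℕ} (c : Fin k) (g : Fin (n G) → Fin k) →
               proper (join1 G) (c ∷ᶠ g) ≡ avoids c g ∧ proper G g
proper-join1 G c g = bool-ext
  (λ h → let h′ = proper-true⁻ (join1 G) (c ∷ᶠ g) h in
         ∧-true⁺ (avoids-true⁺ c g (λ j → h′ zero (suc j) refl))
                 (proper-true⁺ G g (λ i j → h′ (suc i) (suc j))))
  (λ h → proper-true⁺ (join1 G) (c ∷ᶠ g) (join-proper (avoids-true⁻ c g (∧-true⁻ˡ h))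
                                                       (proper-true⁻ G g (∧-true⁻ʳ {avoids c g} h))))
  where
  join-proper : (∀ j → eqF c (g j) ≡ false) → IsProper G g → IsProper (join1 G) (c ∷ᶠ g)
  join-proper c∉g g-proper zero    (suc j) _ = c∉g j
  join-proper c∉g g-proper (suc i) zero    _ = trans (eqF-sym (g i) c) (c∉g i)
  join-proper c∉g g-proper (suc i) (suc j) a = g-proper i j a

∑-punchIn : (m : ℕ) (c : Fin (suc m)) (h : Fin (suc m) → ℕ) → h c ≡ 0 →
            ∑ (allFin (suc m)) h ≡ ∑ (allFin m) (h ∘ punchIn c)
∑-punchIn m       zero    h hc = trans (∑-allFin-suc {m} h) (cong (_+ ∑ (allFin m) (h ∘ suc)) hc)
∑-punchIn (suc m) (suc c) h hc =
  trans (∑-allFin-suc {suc m} h)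
        (trans (cong (h zero +_) (∑-punchIn m c (h ∘ suc) hc)) (≡.sym (∑-allFin-suc {m} (h ∘ punchIn (suc c)))))

colourings : (k N : ℕ) → List (Fin N → Fin k)
colourings k = allFuns (allFin k)

countB-avoids : {m : ℕ} (N : ℕ) (c : Fin (suc m)) (φ : (Fin N → Fin (suc m)) → Bool) → Extensional φ →
                countB (λ g → avoids c g ∧ φ g) (colourings (suc m) N)
                ≡ countB (λ g → φ (punchIn c ∘ g)) (colourings m N)
countB-avoids zero    c φ φ-ext = cong 𝟙 (φ-ext (λ ()))
countB-avoids {m} (suc N) c φ φ-ext = begin
  countB (λ g → avoids c g ∧ φ g) (colourings (suc m) (suc N))
    ≡⟨ countB-allFuns-suc (allFin (suc m)) (λ g → avoids c g ∧ φ g) ⟩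
  ∑ (allFin (suc m)) (λ a → countB (λ g → (not (eqF c a) ∧ avoids c g) ∧ φ (a ∷ᶠ g)) (colourings (suc m) N))
    ≡⟨ ∑-punchIn m c _ (countB-none (colourings (suc m) N) λ g →
         cong (λ b → (not b ∧ avoids c g) ∧ φ (c ∷ᶠ g)) (eqF-refl c)) ⟩
  ∑ (allFin m) (λ a → countB (λ g → (not (eqF c (punchIn c a)) ∧ avoids c g) ∧ φ (punchIn c a ∷ᶠ g))
                             (colourings (suc m) N))
    ≡⟨ ∑-cong (allFin m) (λ a → countB-cong (colourings (suc m) N)
         (λ g → cong (λ b → (not b ∧ avoids c g) ∧ φ (punchIn c a ∷ᶠ g)) (eqF-false (punchInᵢ≢i c a ∘ ≡.sym)))) ⟩
  ∑ (allFin m) (λ a → countB (λ g → avoids c g ∧ φ (punchIn c a ∷ᶠ g)) (colourings (suc m) N))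
    ≡⟨ ∑-cong (allFin m) (λ a → countB-avoids N c (φ ∘ (punchIn c a ∷ᶠ_))
                                   (λ e → φ-ext (λ { zero → refl ; (suc i) → e i }))) ⟩
  ∑ (allFin m) (λ a → countB (λ g → φ (punchIn c a ∷ᶠ (punchIn c ∘ g))) (colourings m N))
    ≡⟨ ∑-cong (allFin m) (λ a → countB-cong (colourings m N) (λ g → φ-ext (λ { zero → refl ; (suc i) → refl }))) ⟩
  ∑ (allFin m) (λ a → countB (λ g → φ (punchIn c ∘ (a ∷ᶠ g))) (colourings m N))
    ≡⟨ ≡.sym (countB-allFuns-suc (allFin m) (λ g → φ (punchIn c ∘ g))) ⟩
  countB (λ g → φ (punchIn c ∘ g)) (colourings m (suc N)) ∎
  where open ≡-Reasoning

P-join1 : (G : Graph) (m : ℕ) → P (join1 G) (suc m) ≡ suc m * P G m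
P-join1 G m = begin
  P (join1 G) (suc m)
    ≡⟨ countB-allFuns-suc (allFin (suc m)) (proper (join1 G)) ⟩
  ∑ (allFin (suc m)) (λ c → countB (λ g → proper (join1 G) (c ∷ᶠ g)) (colourings (suc m) (n G)))
    ≡⟨ ∑-cong (allFin (suc m)) (λ c → countB-cong (colourings (suc m) (n G)) (proper-join1 G c)) ⟩
  ∑ (allFin (suc m)) (λ c → countB (λ g → avoids c g ∧ proper G g) (colourings (suc m) (n G)))
    ≡⟨ ∑-cong (allFin (suc m)) (λ c → countB-avoids (n G) c (proper G)
                                         (λ e → proper-cong G _ _ (λ i j → cong₂ eqF (e i) (e j)))) ⟩
  ∑ (allFin (suc m)) (λ c → countB (λ g → proper G (punchIn c ∘ g)) (colourings m (n G)))
    ≡⟨ ∑-cong (allFin (suc m)) (λ c → countB-cong (colourings m (n G))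
         (λ g → proper-cong G _ g (λ i j → eqF-injective (punchIn c) (punchIn-injective c _ _) (g i) (g j)))) ⟩
  ∑ (allFin (suc m)) (λ _ → P G m)
    ≡⟨ ∑-const (suc m) (P G m) ⟩
  suc m * P G m ∎
  where open ≡-Reasoning

-- The canonical k-fold cover of K

module Canonical (K : Graph) (k : ℕ) where

  M : ℕ
  M = n K * k

  part : Fin M → Fin (n K)
  part = quotient k

  colour : Fin M → Fin k
  colour = remainder {n K} k

  vertex : Fin (n K) → Fin k → Fin M
  vertex = combine

  part-vertex : ∀ u c → part (vertex u c) ≡ u
  part-vertex u c = cong proj₁ (remQuot-combine u c)

  colour-vertex : ∀ u c → colour (vertex u c) ≡ c
  colour-vertex u c = cong proj₂ (remQuot-combine u c)

  vertex-part-colour : ∀ x y → part x ≡ part y → colour x ≡ colour y → x ≡ y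
  vertex-part-colour x y p q =
    trans (≡.sym (combine-remQuot {n K} k x)) (trans (cong₂ vertex p q) (combine-remQuot {n K} k y))

  eqF-vertex : ∀ x u c → eqF x (vertex u c) ≡ eqF (part x) u ∧ eqF (colour x) c
  eqF-vertex x u c = bool-ext
    (λ e → ∧-true⁺ (eqF-true⁺ (trans (cong part (eqF-true⁻ e)) (part-vertex u c)))
                   (eqF-true⁺ (trans (cong colour (eqF-true⁻ e)) (colour-vertex u c))))
    (λ e → eqF-true⁺ (vertex-part-colour x (vertex u c)
                        (trans (eqF-true⁻ (∧-true⁻ˡ e)) (≡.sym (part-vertex u c)))
                        (trans (eqF-true⁻ (∧-true⁻ʳ {eqF (part x) u} e)) (≡.sym (colour-vertex u c)))))

  adjacent : Fin M → Fin M → Bool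
  adjacent x y = if eqF (part x) (part y)
                 then not (eqF (colour x) (colour y))
                 else adj K (part x) (part y) ∧ eqF (colour x) (colour y)

  adjacent-same : ∀ x y → part x ≡ part y → adjacent x y ≡ not (eqF (colour x) (colour y))
  adjacent-same x y e rewrite eqF-true⁺ e = refl

  adjacent-diff : ∀ x y → part x ≢ part y → adjacent x y ≡ adj K (part x) (part y) ∧ eqF (colour x) (colour y)
  adjacent-diff x y ne rewrite eqF-false ne = refl

  adjacent-sym : ∀ x y → adjacent x y ≡ adjacent y x
  adjacent-sym x y = by-cases (part x ≟ part y)
    where
    by-cases : Dec (part x ≡ part y) → adjacent x y ≡ adjacent y x
    by-cases (yes e) = trans (adjacent-same x y e)
                             (trans (cong not (eqF-sym (colour x) (colour y))) (≡.sym (adjacent-same y x (≡.sym e))))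
    by-cases (no ne) = trans (adjacent-diff x y ne)
                             (trans (cong₂ _∧_ (Graph.sym K (part x) (part y)) (eqF-sym (colour x) (colour y)))
                                    (≡.sym (adjacent-diff y x (ne ∘ ≡.sym))))

  graph : Graph
  graph = record
    { n      = M
    ; adj    = adjacent
    ; sym    = adjacent-sym
    ; irrefl = λ x → trans (adjacent-same x x refl) (cong not (eqF-refl (colour x)))
    }

  matched : ∀ x y → adjacent x y ≡ true → part x ≢ part y → adj K (part x) (part y) ≡ true × colour x ≡ colour y
  matched x y xy ne = let h = trans (≡.sym (adjacent-diff x y ne)) xy in
    ∧-true⁻ˡ h , eqF-true⁻ (∧-true⁻ʳ {adj K (part x) (part y)} h)

  cover : Cover K
  cover = record
    { H        = graph
    ; own      = part
    ; clique   = λ x y x≢y e → trans (adjacent-same x y e) (cong not (eqF-false (x≢y ∘ vertex-part-colour x y e)))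
    ; overEdge = λ x y xy ne → proj₁ (matched x y xy ne)
    ; matching = λ x y y′ ne e xy xy′ → vertex-part-colour y y′ e
                   (trans (≡.sym (proj₂ (matched x y xy ne)))
                          (proj₂ (matched x y′ xy′ (λ q → ne (trans q (≡.sym e))))))
    }

  cover-fold : IsMFold cover k
  cover-fold u = begin
    countB (λ x → eqF (part x) u) (allFin M)
      ≡⟨ countB-fibres (λ x → eqF (part x) u) colour (allFin M) ⟩
    ∑ (allFin k) (λ c → countB (λ x → eqF (part x) u ∧ eqF (colour x) c) (allFin M))
      ≡⟨ ∑-cong (allFin k) (λ c → trans (countB-cong (allFin M) (λ x → ≡.sym (eqF-vertex x u c)))
                                         (countB-eqF-allFin (vertex u c))) ⟩
    ∑ (allFin k) (λ _ → 1)
      ≡⟨ trans (∑-const k 1) (*-identityʳ k) ⟩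
    k ∎
    where open ≡-Reasoning

  toSet : (Fin (n K) → Fin k) → Fin M → Bool
  toSet g x = eqF (colour x) (g (part x))

  toSet-vertex : ∀ g u → toSet g (vertex u (g u)) ≡ true
  toSet-vertex g u = eqF-true⁺ (trans (colour-vertex u (g u)) (cong g (≡.sym (part-vertex u (g u)))))

  size-toSet : ∀ g → size (toSet g) ≡ n K
  size-toSet g = begin
    size (toSet g)
      ≡⟨ countB-fibres (toSet g) part (allFin M) ⟩
    ∑ (allFin (n K)) (λ u → countB (λ x → toSet g x ∧ eqF (part x) u) (allFin M))
      ≡⟨ ∑-cong (allFin (n K)) (λ u → trans (countB-cong (allFin M) (single u)) (countB-eqF-allFin (vertex u (g u)))) ⟩
    ∑ (allFin (n K)) (λ _ → 1)
      ≡⟨ trans (∑-const (n K) 1) (*-identityʳ (n K)) ⟩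
    n K ∎
    where
    open ≡-Reasoning
    single : ∀ u x → toSet g x ∧ eqF (part x) u ≡ eqF x (vertex u (g u))
    single u x = begin
      eqF (colour x) (g (part x)) ∧ eqF (part x) u ≡⟨ ∧-comm _ (eqF (part x) u) ⟩
      eqF (part x) u ∧ eqF (colour x) (g (part x)) ≡⟨ eqF-∧-subst (λ v → eqF (colour x) (g v)) (part x) u ⟩
      eqF (part x) u ∧ eqF (colour x) (g u)        ≡⟨ ≡.sym (eqF-vertex x u (g u)) ⟩
      eqF x (vertex u (g u))                       ∎

  independentOfSize-toSet : ∀ g → independentOfSize graph (n K) (toSet g) ≡ proper K g
  independentOfSize-toSet g = bool-ext
    (λ h → proper-true⁺ K g (from-independent (independent-true⁻ graph (toSet g) (∧-true⁻ˡ h))))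
    (λ h → ∧-true⁺ (independent-true⁺ graph (toSet g) (to-independent (proper-true⁻ K g h)))
                   (isYes-true⁺ (size (toSet g) ℕ.≟ n K) (size-toSet g)))
    where
    from-independent : IsIndependent graph (toSet g) → IsProper K g
    from-independent indep i j ij with eqF (g i) (g j) in same
    ... | false = refl
    ... | true  = ⊥-elim (≡true⇒≢false xy (indep x y (toSet-vertex g i) (toSet-vertex g j)))
      where
      x = vertex i (g i)
      y = vertex j (g j)
      parts-differ : part x ≢ part y
      parts-differ e = ≡true⇒≢false (subst (λ v → adj K i v ≡ true) i≡j ij) (irrefl K i)
        where
        i≡j : j ≡ i
        i≡j = trans (≡.sym (part-vertex j (g j))) (trans (≡.sym e) (part-vertex i (g i)))
      xy : adjacent x y ≡ true
      xy = begin
        adjacent x y                                        ≡⟨ adjacent-diff x y parts-differ ⟩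
        adj K (part x) (part y) ∧ eqF (colour x) (colour y) ≡⟨ cong₂ (λ a b → adj K a b ∧ eqF (colour x) (colour y))
                                                                     (part-vertex i (g i)) (part-vertex j (g j)) ⟩
        adj K i j ∧ eqF (colour x) (colour y)               ≡⟨ cong₂ (λ c d → adj K i j ∧ eqF c d)
                                                                     (colour-vertex i (g i)) (colour-vertex j (g j)) ⟩
        adj K i j ∧ eqF (g i) (g j)                         ≡⟨ ∧-true⁺ ij same ⟩
        true                                                ∎
        where open ≡-Reasoning
    to-independent : IsProper K g → IsIndependent graph (toSet g)
    to-independent g-proper x y x∈ y∈ = by-cases (part x ≟ part y)
      where
      cx : colour x ≡ g (part x)
      cx = eqF-true⁻ x∈
      cy : colour y ≡ g (part y)
      cy = eqF-true⁻ y∈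
      by-cases : Dec (part x ≡ part y) → adjacent x y ≡ false
      by-cases (yes e) = trans (adjacent-same x y e) (cong not (eqF-true⁺ (trans cx (trans (cong g e) (≡.sym cy)))))
      by-cases (no ne) = trans (adjacent-diff x y ne) (across (adj K (part x) (part y)) refl)
        where
        across : ∀ b → adj K (part x) (part y) ≡ b → b ∧ eqF (colour x) (colour y) ≡ false
        across false _  = refl
        across true  xy = trans (cong₂ eqF cx cy) (g-proper (part x) (part y) xy)

  module FromSet (S : Fin M → Bool) (S-colouring : independentOfSize graph (n K) S ≡ true) where

    S-independent : IsIndependent graph S
    S-independent = independent-true⁻ graph S (∧-true⁻ˡ S-colouring)

    -- S meets each part at most once and has n K elements, hence meets each part exactly once.
    meets-once : ∀ u → countB (λ x → S x ∧ eqF (part x) u) (allFin M) ≡ 1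
    meets-once = h≤1∧∑≡n⇒h≡1 (n K) _
      (λ u → countB-≤1 _ (allFin M) (allFin⁺ M) λ a b ha hb →
         independent-own-injective cover S S-independent a b (∧-true⁻ˡ ha) (∧-true⁻ˡ hb)
           (trans (eqF-true⁻ (∧-true⁻ʳ {S a} ha)) (≡.sym (eqF-true⁻ (∧-true⁻ʳ {S b} hb)))))
      (trans (≡.sym (countB-fibres S part (allFin M)))
             (isYes-true⁻ (size S ℕ.≟ n K) (∧-true⁻ʳ {independent graph S} S-colouring)))

    rep : Fin (n K) → Fin M
    rep u = proj₁ (countB-witness _ (allFin M) (meets-once u))

    rep-∈ : ∀ u → S (rep u) ≡ true
    rep-∈ u = ∧-true⁻ˡ (proj₂ (countB-witness _ (allFin M) (meets-once u)))

    part-rep : ∀ u → part (rep u) ≡ u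
    part-rep u = eqF-true⁻ (∧-true⁻ʳ {S (rep u)} (proj₂ (countB-witness _ (allFin M) (meets-once u))))

    g : Fin (n K) → Fin k
    g u = colour (rep u)

    S≗toSet : S ≗ toSet g
    S≗toSet x = bool-ext
      (λ x∈ → eqF-true⁺ (cong colour (independent-own-injective cover S S-independent x (rep (part x))
                                         x∈ (rep-∈ (part x)) (≡.sym (part-rep (part x))))))
      (λ x∈ → subst (λ z → S z ≡ true)
                    (vertex-part-colour (rep (part x)) x (part-rep (part x)) (≡.sym (eqF-true⁻ x∈)))
                    (rep-∈ (part x)))

    agree-toSet : ∀ g′ → agree Bool._≟_ S (toSet g′) ≡ agree _≟_ g′ g
    agree-toSet g′ = bool-ext
      (λ h → agree-true⁺ _≟_ g′ g λ u →
         let c≡ = eqF-true⁻ (trans (≡.sym (agree-true⁻ Bool._≟_ S (toSet g′) h (rep u))) (rep-∈ u)) in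
         ≡.sym (trans c≡ (cong g′ (part-rep u))))
      (λ h → agree-true⁺ Bool._≟_ S (toSet g′) λ x →
         trans (S≗toSet x) (cong (λ c → eqF (colour x) c) (≡.sym (agree-true⁻ _≟_ g′ g h (part x)))))

  numColourings-cover : numColourings cover ≡ P K k
  numColourings-cover = countB-double ψ (proper K) (λ S g → agree Bool._≟_ S (toSet g) ∧ ψ S)
    (subsets M) (colourings k (n K)) sets-fibre colourings-fibre
    where
    ψ = independentOfSize graph (n K)
    ψ-extensional : Extensional ψ
    ψ-extensional e = cong₂ _∧_ (independent-cong graph e) (cong (λ s → ⌊ s ℕ.≟ n K ⌋) (countB-cong (allFin M) e))
    sets-fibre : ∀ S → countB (λ g → agree Bool._≟_ S (toSet g) ∧ ψ S) (colourings k (n K)) ≡ 𝟙 (ψ S)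
    sets-fibre S with ψ S in ψS
    ... | false = countB-none (colourings k (n K)) (λ g → ∧-zeroʳ _)
    ... | true  = trans (countB-cong (colourings k (n K)) (λ g → cong (_∧ true) (FromSet.agree-toSet S ψS g)))
                        (countB-agree-∧ _≟_ (allFin k) countB-eqF-allFin (n K) (FromSet.g S ψS) (λ _ → true) (λ _ → refl))
    colourings-fibre : ∀ g → countB (λ S → agree Bool._≟_ S (toSet g) ∧ ψ S) (subsets M) ≡ 𝟙 (proper K g)
    colourings-fibre g =
      trans (countB-agree-∧ Bool._≟_ Bools (λ { true → refl ; false → refl }) M (toSet g) ψ ψ-extensional)
            (cong 𝟙 (independentOfSize-toSet g))

lemma2p2 : (G : Graph) (m : ℕ) → PDP≡ G m (P G m) → PDP≡ (join1 G) (suc m) (P (join1 G) (suc m))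
lemma2p2 G m (_ , P≤) =
  (cover , cover-fold , numColourings-cover) ,
  λ 𝓗 𝓗-fold → subst (_≤ numColourings 𝓗) (≡.sym (P-join1 G m)) ([1+m]*P≤numColourings G m P≤ 𝓗 𝓗-fold)
  where open Canonical (join1 G) (suc m)
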